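{- For every connected graph $G$, $c_d(G) \le \frac{\Delta}{\overline{d}} - 1$, where $\Delta$ is the maximum degree and $\overline{d}$ is the average degree of $G$.
   Context: All graphs are finite, simple, undirected and connected. For a vector $v \in \mathbb{R}^n_+$ with mean $\mu = \frac1n\sum_i v_i$ and standard deviation $\sigma$, $\sigma^2 = \frac1n\sum_i (v_i-\mu)^2$, set $c_v = (\sigma/\mu)^2$. $c_d(G)$ denotes $c_d$ for the degree vector $d = (\deg(v))_{v \in V(G)}$ of $G$. -}

module Defs where

open import Data.Nat as ℕ using (ℕ; zero; suc)
open import Data.Bool using (Bool; true; false; if_then_else_)
open import Data.Fin using (Fin)
open import Data.Nat.ListAction using (sum)
open import Data.List using (List; []; _∷_; map; foldr; length; filterᵇ)
open import Data.List using (allFin)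
open import Data.Product using (Σ; _×_; _,_)
open import Relation.Binary.PropositionalEquality using (_≡_)
open import Data.Integer using (+_)
open import Data.Rational as ℚ using (ℚ; _+_; _*_; _-_; _÷_; _/_; NonZero)

record Graph (n : ℕ) : Set where
  field
    adj   : Fin n → Fin n → Bool
    sym   : ∀ u v → adj u v ≡ adj v u
    irrefl : ∀ v → adj v v ≡ false
open Graph public

data Walk {n : ℕ} (G : Graph n) : Fin n → Fin n → Set where
  here : ∀ {v} → Walk G v v
  step : ∀ {u w v} → adj G u w ≡ true → Walk G w v → Walk G u v

Connected : ∀ {n} → Graph n → Set
Connected {n} G = ∀ (u v : Fin n) → Walk G u v

deg : ∀ {n} → Graph n → Fin n → ℕ
deg {n} G v = length (filterᵇ (adj G v) (allFin n))

degs : ∀ {n} → Graph n → List ℕ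
degs {n} G = map (deg G) (allFin n)

maxDeg : ∀ {n} → Graph n → ℕ
maxDeg G = foldr ℕ._⊔_ 0 (degs G)

ℕtoℚ : ℕ → ℚ
ℕtoℚ k = (+ k) / 1

-- mean μ = (1/n) Σ d_v  (for n = 0 it is defined as 0, irrelevant below)
meanDeg : ∀ {n} → Graph n → ℚ
meanDeg {zero} G = ℚ.0ℚ
meanDeg {suc n} G = (+ sum (degs G)) / suc n

varDeg : ∀ {n} → Graph n → ℚ
varDeg {zero} G = ℚ.0ℚ
varDeg {suc n} G =
  foldr _+_ ℚ.0ℚ (map (λ d → (ℕtoℚ d - meanDeg G) * (ℕtoℚ d - meanDeg G)) (degs G))
    * ((+ 1) / suc n)

-- c_d(G) = (σ/μ)² = (σ² / μ) / μ, defined when μ ≠ 0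
cd : ∀ {n} (G : Graph n) → .{{_ : NonZero (meanDeg G)}} → ℚ
cd G = (varDeg G ÷ meanDeg G) ÷ meanDeg G

{-# OPTIONS --safe #-}
-- Since 0 ≤ d ≤ Δ for every degree d, we have d² ≤ Δ d, so (d - μ)² ≤ (Δ - 2μ) d + μ².
-- Averaging over the vertices and using that the degrees average to μ gives
-- σ² ≤ (Δ - 2μ) μ + μ² = μ (Δ - μ), and dividing by μ² yields σ²/μ² ≤ Δ/μ - 1.
module Submission where

open import Defs
open import Data.Nat using (ℕ; _≤_)
open import Data.Rational using (ℚ; _-_; _÷_; NonZero) renaming (_≤_ to _≤ℚ_)
open import Data.Rational using (1ℚ)

open import Data.Nat as ℕ using (suc)
import Data.Nat.Properties as ℕ
open import Data.Nat.Coprimality using (1-coprimeTo)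
import Data.Nat.Coprimality as Coprime
open import Data.Nat.ListAction using (sum)
open import Data.Integer as ℤ using (+_)
import Data.Integer.Properties as ℤ
open import Data.Rational as ℚ using (mkℚ; _+_; _*_; -_; 1/_; 0ℚ; NonNegative)
open import Data.Rational.Properties
import Data.Rational.Unnormalised as ℚᵘ
import Data.Rational.Unnormalised.Properties as ℚᵘ
open import Data.List using (List; []; _∷_; map; foldr; length; allFin)
open import Data.List.Properties using (length-map; length-tabulate)
open import Data.List.Relation.Unary.All as All using (All; []; _∷_)
open import Relation.Nullary.Decidable using (dec⇒maybe)
open import Tactic.RingSolver using (solve-∀)
open import Tactic.RingSolver.Core.AlmostCommutativeRing
  using (AlmostCommutativeRing; fromCommutativeRing)
open import Relation.Binary.PropositionalEquality using (_≡_; cong; cong₂; subst₂; trans)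
import Relation.Binary.PropositionalEquality as ≡

ℚ-ring : AlmostCommutativeRing _ _
ℚ-ring = fromCommutativeRing +-*-commutativeRing (λ x → dec⇒maybe (0ℚ ≟ x))

ℕtoℚ≡mkℚ : ∀ k → ℕtoℚ k ≡ mkℚ (+ k) 0 (Coprime.sym (1-coprimeTo k))
ℕtoℚ≡mkℚ k = normalize-coprime (Coprime.sym (1-coprimeTo k))

ℕtoℚ-+ : ∀ a b → ℕtoℚ (a ℕ.+ b) ≡ ℕtoℚ a + ℕtoℚ b
ℕtoℚ-+ a b rewrite ℕtoℚ≡mkℚ a | ℕtoℚ≡mkℚ b =
  cong (ℚ._/ 1) (trans (ℤ.pos-+ a b)
    (≡.sym (cong₂ ℤ._+_ (ℤ.*-identityʳ (+ a)) (ℤ.*-identityʳ (+ b)))))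

ℕtoℚ-* : ∀ a b → ℕtoℚ (a ℕ.* b) ≡ ℕtoℚ a * ℕtoℚ b
ℕtoℚ-* a b rewrite ℕtoℚ≡mkℚ a | ℕtoℚ≡mkℚ b = cong (ℚ._/ 1) (ℤ.pos-* a b)

ℕtoℚ-mono-≤ : ∀ {a b} → a ≤ b → ℕtoℚ a ≤ℚ ℕtoℚ b
ℕtoℚ-mono-≤ {a} {b} a≤b rewrite ℕtoℚ≡mkℚ a | ℕtoℚ≡mkℚ b =
  ℚ.*≤* (subst₂ ℤ._≤_ (≡.sym (ℤ.*-identityʳ (+ a))) (≡.sym (ℤ.*-identityʳ (+ b))) (ℤ.+≤+ a≤b))

/-*-cancelʳ : ∀ k m → ((+ k) ℚ./ suc m) * ℕtoℚ (suc m) ≡ ℕtoℚ k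
/-*-cancelʳ k m = toℚᵘ-injective (begin-equality
  ℚ.toℚᵘ ((+ k) ℚ./ suc m * ℕtoℚ (suc m))
    ≃⟨ toℚᵘ-homo-* ((+ k) ℚ./ suc m) (ℕtoℚ (suc m)) ⟩
  ℚ.toℚᵘ ((+ k) ℚ./ suc m) ℚᵘ.* ℚ.toℚᵘ (ℕtoℚ (suc m))
    ≃⟨ ℚᵘ.*-cong (toℚᵘ-fromℚᵘ (ℚᵘ.mkℚᵘ (+ k) m)) (ℚᵘ.≃-reflexive (cong ℚ.toℚᵘ (ℕtoℚ≡mkℚ (suc m)))) ⟩
  ℚᵘ.mkℚᵘ (+ k) m ℚᵘ.* ℚᵘ.mkℚᵘ (+ suc m) 0
    ≃⟨ ℚᵘ.*≡* (trans (ℤ.*-identityʳ _) (cong (λ j → + k ℤ.* + suc j) (≡.sym (ℕ.*-identityʳ m)))) ⟩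
  ℚᵘ.mkℚᵘ (+ k) 0
    ≡⟨ cong ℚ.toℚᵘ (≡.sym (ℕtoℚ≡mkℚ k)) ⟩
  ℚ.toℚᵘ (ℕtoℚ k) ∎)
  where open ℚᵘ.≤-Reasoning

sumℚ : List ℚ → ℚ
sumℚ = foldr _+_ 0ℚ

sumℚ-map-mono-≤ : ∀ {A : Set} {f g : A → ℚ} {xs : List A} →
  All (λ x → f x ≤ℚ g x) xs → sumℚ (map f xs) ≤ℚ sumℚ (map g xs)
sumℚ-map-mono-≤ []             = ≤-refl
sumℚ-map-mono-≤ (fx≤gx ∷ ps) = +-mono-≤ fx≤gx (sumℚ-map-mono-≤ ps)

sumℚ-map-affine : ∀ a b (ds : List ℕ) →
  sumℚ (map (λ d → a * ℕtoℚ d + b) ds) ≡ a * ℕtoℚ (sum ds) + ℕtoℚ (length ds) * b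
sumℚ-map-affine a b []       = empty-sum a b
  where
  empty-sum : ∀ a b → 0ℚ ≡ a * 0ℚ + 0ℚ * b
  empty-sum = solve-∀ ℚ-ring
sumℚ-map-affine a b (d ∷ ds) = begin
  a * ℕtoℚ d + b + sumℚ (map (λ d → a * ℕtoℚ d + b) ds)
    ≡⟨ cong (_+_ (a * ℕtoℚ d + b)) (sumℚ-map-affine a b ds) ⟩
  a * ℕtoℚ d + b + (a * ℕtoℚ (sum ds) + ℕtoℚ (length ds) * b)
    ≡⟨ regroup a b (ℕtoℚ d) (ℕtoℚ (sum ds)) (ℕtoℚ (length ds)) ⟩
  a * (ℕtoℚ d + ℕtoℚ (sum ds)) + (1ℚ + ℕtoℚ (length ds)) * b
    ≡⟨ cong₂ (λ s l → a * s + l * b) (≡.sym (ℕtoℚ-+ d (sum ds))) (≡.sym (ℕtoℚ-+ 1 (length ds))) ⟩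
  a * ℕtoℚ (d ℕ.+ sum ds) + ℕtoℚ (suc (length ds)) * b ∎
  where
  open ≡.≡-Reasoning
  regroup : ∀ a b x s l → a * x + b + (a * s + l * b) ≡ a * (x + s) + (1ℚ + l) * b
  regroup = solve-∀ ℚ-ring

sqDev : ℚ → ℕ → ℚ
sqDev μ d = (ℕtoℚ d - μ) * (ℕtoℚ d - μ)

sqDev-≤-affine : ∀ {M d} μ → d ≤ M → sqDev μ d ≤ℚ (ℕtoℚ M - (μ + μ)) * ℕtoℚ d + μ * μ
sqDev-≤-affine {M} {d} μ d≤M = begin
  sqDev μ d                                ≡⟨ expand x μ ⟩
  x * x + (- (μ + μ) * x + μ * μ)          ≤⟨ +-monoˡ-≤ (- (μ + μ) * x + μ * μ) x²≤Mx ⟩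
  ℕtoℚ M * x + (- (μ + μ) * x + μ * μ)     ≡⟨ collect (ℕtoℚ M) x μ ⟩
  (ℕtoℚ M - (μ + μ)) * x + μ * μ           ∎
  where
  open ≤-Reasoning
  x = ℕtoℚ d
  x²≤Mx : x * x ≤ℚ ℕtoℚ M * x
  x²≤Mx = subst₂ _≤ℚ_ (ℕtoℚ-* d d) (ℕtoℚ-* M d) (ℕtoℚ-mono-≤ (ℕ.*-monoˡ-≤ d d≤M))
  expand : ∀ x μ → (x - μ) * (x - μ) ≡ x * x + (- (μ + μ) * x + μ * μ)
  expand = solve-∀ ℚ-ring
  collect : ∀ M x μ → M * x + (- (μ + μ) * x + μ * μ) ≡ (M - (μ + μ)) * x + μ * μ
  collect = solve-∀ ℚ-ring

variance-≤-mean*[max-mean] : ∀ m M (ds : List ℕ) → length ds ≡ suc m → All (_≤ M) ds →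
  let μ = (+ sum ds) ℚ./ suc m in
  sumℚ (map (sqDev μ) ds) * ((+ 1) ℚ./ suc m) ≤ℚ μ * (ℕtoℚ M - μ)
variance-≤-mean*[max-mean] m M ds len ds≤M = begin
  sumℚ (map (sqDev μ) ds) * r
    ≤⟨ *-monoʳ-≤-nonNeg r {{normalize-nonNeg 1 (suc m)}}
         (sumℚ-map-mono-≤ (All.map (sqDev-≤-affine μ) ds≤M)) ⟩
  sumℚ (map (λ d → (ℕtoℚ M - (μ + μ)) * ℕtoℚ d + μ * μ) ds) * r
    ≡⟨ cong (_* r) (sumℚ-map-affine (ℕtoℚ M - (μ + μ)) (μ * μ) ds) ⟩
  ((ℕtoℚ M - (μ + μ)) * ℕtoℚ (sum ds) + ℕtoℚ (length ds) * (μ * μ)) * r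
    ≡⟨ cong₂ (λ s l → ((ℕtoℚ M - (μ + μ)) * s + ℕtoℚ l * (μ * μ)) * r)
         (≡.sym (/-*-cancelʳ (sum ds) m)) len ⟩
  ((ℕtoℚ M - (μ + μ)) * (μ * n) + n * (μ * μ)) * r
    ≡⟨ factor (ℕtoℚ M) μ n r ⟩
  μ * (ℕtoℚ M - μ) * (r * n)
    ≡⟨ cong (μ * (ℕtoℚ M - μ) *_) (/-*-cancelʳ 1 m) ⟩
  μ * (ℕtoℚ M - μ) * 1ℚ
    ≡⟨ *-identityʳ (μ * (ℕtoℚ M - μ)) ⟩
  μ * (ℕtoℚ M - μ) ∎
  where
  open ≤-Reasoning
  μ = (+ sum ds) ℚ./ suc m
  n = ℕtoℚ (suc m)
  r = (+ 1) ℚ./ suc m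
  factor : ∀ M μ n r → ((M - (μ + μ)) * (μ * n) + n * (μ * μ)) * r ≡ μ * (M - μ) * (r * n)
  factor = solve-∀ ℚ-ring

÷-÷-≤-÷-1 : ∀ v M μ .{{_ : NonNegative μ}} .{{_ : NonZero μ}} →
  v ≤ℚ μ * (M - μ) → (v ÷ μ) ÷ μ ≤ℚ M ÷ μ - 1ℚ
÷-÷-≤-÷-1 v M μ {{_}} {{μ≢0}} v≤ = begin
  v * i * i                              ≤⟨ *-monoʳ-≤-nonNeg i (*-monoʳ-≤-nonNeg i v≤) ⟩
  μ * (M - μ) * i * i                    ≡⟨ spread M μ i ⟩
  M * (μ * i) * i - (μ * i) * (μ * i)    ≡⟨ cong (λ j → M * j * i - j * j) (*-inverseʳ μ) ⟩
  M * 1ℚ * i - 1ℚ * 1ℚ                   ≡⟨ cong (λ k → k * i - 1ℚ) (*-identityʳ M) ⟩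
  M * i - 1ℚ                             ∎
  where
  open ≤-Reasoning
  i = (1/ μ) {{μ≢0}}
  instance
    i-nonNeg : NonNegative i
    i-nonNeg = pos⇒nonNeg i {{1/pos⇒pos μ {{nonNeg∧nonZero⇒pos μ}}}}
  spread : ∀ M μ i → μ * (M - μ) * i * i ≡ M * (μ * i) * i - (μ * i) * (μ * i)
  spread = solve-∀ ℚ-ring

xs≤foldr-⊔ : ∀ (ds : List ℕ) → All (_≤ foldr ℕ._⊔_ 0 ds) ds
xs≤foldr-⊔ []       = []
xs≤foldr-⊔ (d ∷ ds) =
  ℕ.m≤m⊔n d _ ∷ All.map (λ p → ℕ.≤-trans p (ℕ.m≤n⊔m d _)) (xs≤foldr-⊔ ds)

mainTheorem4 : ∀ (n : ℕ) (G : Graph n) → 2 ≤ n → Connected G →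
    .{{nz : NonZero (meanDeg G)}} →
    cd G ≤ℚ ((ℕtoℚ (maxDeg G) ÷ meanDeg G) - 1ℚ)
mainTheorem4 (suc m) G _ _ =
  ÷-÷-≤-÷-1 (varDeg G) (ℕtoℚ (maxDeg G)) (meanDeg G) {{normalize-nonNeg (sum (degs G)) (suc m)}}
    (variance-≤-mean*[max-mean] m (maxDeg G) (degs G) |degs| (xs≤foldr-⊔ (degs G)))
  where
  |degs| : length (degs G) ≡ suc m
  |degs| = trans (length-map (deg G) (allFin (suc m))) (length-tabulate {n = suc m} (λ v → v))
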